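{- If $h(z,\vec y/\vec a)$ is in ${\sf PCSF}$, then so is the function $f(x,\vec y/\vec a)=\bigcup\{h(z,\vec y/\vec a): z\in x\}$.
   Context: Functions are set-theoretic functions on the universe of sets, written $f(x_1,\ldots,x_n/a_1,\ldots,a_m)$: arguments before the slash are called normal, after it safe (either list may be empty, written $-$). The class ${\sf PCSF}^-$ consists of functions with no normal arguments; it contains the projections $\pi^{ -,m}_j(-/a_1,\ldots,a_m)=a_j$, $\mathrm{pair}(-/a,b)=\{a,b\}$, $\mathrm{null}(-/-)=\emptyset$, $\mathrm{union}(-/a)=\bigcup a$, and $\mathrm{Cond}_\in(-/a,b,c,d)$, which equals $a$ if $c\in d$ and $b$ otherwise; and it is closed under composition $f(-/\vec a)=h(-/t_1(-/\vec a),\ldots,t_k(-/\vec a))$ and under safe separation: if $h(-/\vec a,b)\in{\sf PCSF}^-$ then $f(-/\vec a,c)=\{b\in c: h(-/\vec a,b)\neq\emptyset\}\in{\sf PCSF}^-$. The class ${\sf PCSF}$ is the smallest class containing ${\sf PCSF}^-$ and all projections $\pi^{n,m}_j(x_1,\ldots,x_n/x_{n+1},\ldots,x_{n+m})=x_j$, and closed under safe composition $f(\vec x/\vec a)=h(r_1(\vec x/-),\ldots,r_k(\vec x/-)/t_1(\vec x/\vec a),\ldots,t_l(\vec x/\vec a))$ (with $h,r_i,t_j\in{\sf PCSF}$, the $r_i$ having no safe arguments) and predicative set recursion $f(x,\vec y/\vec a)=h(x,\vec y/\vec a,\{f(z,\vec y/\vec a): z\in x\})$ (with $h\in{\sf PCSF}$).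 -}

module Defs where

open import Data.Nat using (ℕ; zero; suc; _+_)
open import Data.Fin using (Fin)
open import Data.Vec using (Vec; []; _∷_; _∷ʳ_; lookup; _++_; tabulate; init; last)
open import Data.Product using (Σ; _×_; _,_; proj₁; proj₂)
open import Data.Sum using (_⊎_; inj₁; inj₂)
open import Data.Empty using (⊥; ⊥-elim)
open import Data.Bool using (Bool; true; false)
open import Relation.Nullary using (¬_)

-- The universe of sets: Aczel's model of (well-founded) sets.

data V : Set₁ where
  sup : (A : Set) → (A → V) → V

index : V → Set
index (sup A _) = A

elt : (x : V) → index x → V
elt (sup _ f) = f

infix 4 _≐_ _∈_
_≐_ : V → V → Set
sup A f ≐ sup B g = ((a : A) → Σ B λ b → f a ≐ g b) × ((b : B) → Σ A λ a → f a ≐ g b)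

_∈_ : V → V → Set
x ∈ sup A f = Σ A λ a → x ≐ f a

∅ : V
∅ = sup ⊥ ⊥-elim

pairV : V → V → V
pairV a b = sup Bool λ { true → a ; false → b }

⋃ : V → V
⋃ (sup A f) = sup (Σ A λ a → index (f a)) λ p → elt (f (proj₁ p)) (proj₂ p)

sepV : (V → Set) → V → V
sepV P (sup A f) = sup (Σ A λ a → P (f a)) λ p → f (proj₁ p)

-- Cond_∈(a,b,c,d) = a if c ∈ d, b otherwise
-- (its elements: those of a when c ∈ d, those of b when ¬ c ∈ d;
--  under excluded middle this is exactly a or b)
condV : V → V → V → V → V
condV a b c d =
  sup ((c ∈ d × index a) ⊎ (¬ (c ∈ d) × index b))
      λ { (inj₁ (_ , i)) → elt a i ; (inj₂ (_ , j)) → elt b j }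

image : (V → V) → V → V
image F x = sup (index x) λ i → F (elt x i)

ExcludedMiddle : Set₁
ExcludedMiddle = (P : Set) → P ⊎ ¬ P

-- Codes for PCSF⁻ (m safe arguments, no normal arguments)

data PCSF⁻ : ℕ → Set where
  proj  : ∀ {m} → Fin m → PCSF⁻ m
  pair  : PCSF⁻ 2
  null  : PCSF⁻ 0
  union : PCSF⁻ 1
  cond  : PCSF⁻ 4
  comp  : ∀ {k m} → PCSF⁻ k → (Fin k → PCSF⁻ m) → PCSF⁻ m
  sep   : ∀ {m} → PCSF⁻ (suc m) → PCSF⁻ (suc m)

⟦_⟧⁻ : ∀ {m} → PCSF⁻ m → Vec V m → V
⟦ proj j ⟧⁻ as = lookup as j
⟦ pair ⟧⁻ (a ∷ b ∷ []) = pairV a b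
⟦ null ⟧⁻ [] = ∅
⟦ union ⟧⁻ (a ∷ []) = ⋃ a
⟦ cond ⟧⁻ (a ∷ b ∷ c ∷ d ∷ []) = condV a b c d
⟦ comp h ts ⟧⁻ as = ⟦ h ⟧⁻ (tabulate λ i → ⟦ ts i ⟧⁻ as)
⟦ sep h ⟧⁻ as = sepV (λ b → ¬ (⟦ h ⟧⁻ (init as ∷ʳ b) ≐ ∅)) (last as)

-- Codes for PCSF (n normal arguments, m safe arguments)

data PCSF : ℕ → ℕ → Set where
  base  : ∀ {m} → PCSF⁻ m → PCSF 0 m
  proj  : ∀ {n m} → Fin (n + m) → PCSF n m
  scomp : ∀ {k l n m} → PCSF k l → (Fin k → PCSF n 0) → (Fin l → PCSF n m) → PCSF n m
  rec   : ∀ {n m} → PCSF (suc n) (suc m) → PCSF (suc n) m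

recV : ∀ {n m} → (Vec V (suc n) → Vec V (suc m) → V) → V → Vec V n → Vec V m → V
recV H (sup A g) ys as = H (sup A g ∷ ys) (as ∷ʳ sup A λ i → recV H (g i) ys as)

⟦_⟧ : ∀ {n m} → PCSF n m → Vec V n → Vec V m → V
⟦ base g ⟧ [] as = ⟦ g ⟧⁻ as
⟦ proj j ⟧ xs as = lookup (xs ++ as) j
⟦ scomp h rs ts ⟧ xs as = ⟦ h ⟧ (tabulate λ i → ⟦ rs i ⟧ xs []) (tabulate λ i → ⟦ ts i ⟧ xs as)
⟦ rec h ⟧ (x ∷ ys) as = recV ⟦ h ⟧ x ys as

module Submission where

-- A predicative recursion only sees h at x and the previous values
-- {f(z) : z ∈ x}, while ⋃{h(z) : z ∈ x} needs h at the elements of x.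
-- So we recurse on a function r that carries both pieces of data as a
-- tagged pair
--     r(x) = tag(h(x), ⋃{h(z) : z ∈ x}),   tag(a, c) = {{∅, a}, {{c}}},
-- where the left component {∅, a} contains ∅ and the right one {{c}} does
-- not.  Testing "∅ ∈ w" is a safe separation (via Cond_∈), so from the set
-- b = {r(z) : z ∈ x} of previous values the PCSF⁻ function unionMarked
-- recovers ⋃{h(z) : z ∈ x}, and the PCSF⁻ function unwrap reads off the
-- right component of r(x).  Then f(x) = unwrap(r(x)).

open import Defs
open import Level using (0ℓ) renaming (suc to lsuc)
open import Data.Nat using (ℕ; suc)
open import Data.Fin using (Fin; zero; suc; _↑ˡ_; _↑ʳ_; inject₁; fromℕ)
open import Data.Vec using (Vec; _∷_; []; lookup; tabulate; _++_; _∷ʳ_)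
open import Data.Vec.Properties using (lookup-++ˡ; lookup-++ʳ; tabulate∘lookup; tabulate-cong)
open import Data.Product using (Σ; _,_; proj₁; proj₂)
open import Data.Sum using (inj₁; inj₂)
open import Data.Empty using (⊥-elim)
open import Data.Bool using (true; false)
open import Relation.Nullary using (¬_)
open import Relation.Binary.Bundles using (Setoid)
open import Relation.Binary.PropositionalEquality using (_≡_; refl; cong; cong₂; trans)

≐-refl : ∀ x → x ≐ x
≐-refl (sup A f) = (λ a → a , ≐-refl (f a)) , (λ a → a , ≐-refl (f a))

≐-sym : ∀ {x y} → x ≐ y → y ≐ x
≐-sym {sup A f} {sup B g} (p , q) =
  (λ b → proj₁ (q b) , ≐-sym (proj₂ (q b))) , (λ a → proj₁ (p a) , ≐-sym (proj₂ (p a)))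

≐-trans : ∀ {x y z} → x ≐ y → y ≐ z → x ≐ z
≐-trans {sup A f} {sup B g} {sup C h} (p , q) (p' , q') =
  (λ a → proj₁ (p' (proj₁ (p a))) , ≐-trans (proj₂ (p a)) (proj₂ (p' (proj₁ (p a))))) ,
  (λ c → proj₁ (q (proj₁ (q' c))) , ≐-trans (proj₂ (q (proj₁ (q' c)))) (proj₂ (q' c)))

≐-setoid : Setoid (lsuc 0ℓ) 0ℓ
≐-setoid = record
  { Carrier = V
  ; _≈_ = _≐_
  ; isEquivalence = record { refl = λ {x} → ≐-refl x ; sym = ≐-sym ; trans = ≐-trans }
  }

≐-forth : ∀ {x y} → x ≐ y → (i : index x) → Σ (index y) λ j → elt x i ≐ elt y j
≐-forth {sup A f} {sup B g} (p , q) = p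

≐-back : ∀ {x y} → x ≐ y → (j : index y) → Σ (index x) λ i → elt x i ≐ elt y j
≐-back {sup A f} {sup B g} (p , q) = q

∈-respʳ : ∀ {c d d'} → d ≐ d' → c ∈ d → c ∈ d'
∈-respʳ {d = sup A f} {sup B g} (p , q) (a , e) = proj₁ (p a) , ≐-trans e (proj₂ (p a))

⋃-cong : ∀ {x y} → x ≐ y → ⋃ x ≐ ⋃ y
⋃-cong {sup A f} {sup B g} (p , q) =
  (λ { (a , i) → let (b , e) = p a ; (j , e') = ≐-forth e i in (b , j) , e' }) ,
  (λ { (b , j) → let (a , e) = q b ; (i , e') = ≐-back e j in (a , i) , e' })

sepV-cong : (P : V → Set) → (∀ {u v} → u ≐ v → P u → P v) →
            ∀ {x y} → x ≐ y → sepV P x ≐ sepV P y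
sepV-cong P resp {sup A f} {sup B g} (p , q) =
  (λ { (a , pa) → let (b , e) = p a in (b , resp e pa) , e }) ,
  (λ { (b , pb) → let (a , e) = q b in (a , resp (≐-sym e) pb) , e })

condV-congʳ : ∀ a b c {d d'} → d ≐ d' → condV a b c d ≐ condV a b c d'
condV-congʳ a b c e =
  (λ { (inj₁ (m , i)) → inj₁ (∈-respʳ e m , i) , ≐-refl (elt a i)
     ; (inj₂ (m , i)) → inj₂ ((λ m' → m (∈-respʳ (≐-sym e) m')) , i) , ≐-refl (elt b i) }) ,
  (λ { (inj₁ (m , i)) → inj₁ (∈-respʳ (≐-sym e) m , i) , ≐-refl (elt a i)
     ; (inj₂ (m , i)) → inj₂ ((λ m' → m (∈-respʳ e m')) , i) , ≐-refl (elt b i) })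

image-cong : ∀ {F G : V → V} → (∀ z → F z ≐ G z) → ∀ x → image F x ≐ image G x
image-cong e (sup A g) = (λ i → i , e (g i)) , (λ i → i , e (g i))

condV-inhabitedˡ : ∀ {a b c d} → c ∈ d → index a → ¬ (condV a b c d ≐ ∅)
condV-inhabitedˡ m i e = proj₁ (proj₁ e (inj₁ (m , i)))

condV-inhabitedʳ : ∀ {a b c d} → ¬ (c ∈ d) → index b → ¬ (condV a b c d ≐ ∅)
condV-inhabitedʳ m i e = proj₁ (proj₁ e (inj₂ (m , i)))

condV-emptyˡ : ∀ {a b c d} → c ∈ d → ¬ index a → condV a b c d ≐ ∅
condV-emptyˡ m na =
  (λ { (inj₁ (_ , i)) → ⊥-elim (na i) ; (inj₂ (m' , _)) → ⊥-elim (m' m) }) , (λ ())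

condV-emptyʳ : ∀ {a b c d} → ¬ (c ∈ d) → ¬ index b → condV a b c d ≐ ∅
condV-emptyʳ m nb =
  (λ { (inj₁ (m' , _)) → ⊥-elim (m m') ; (inj₂ (_ , j)) → ⊥-elim (nb j) }) , (λ ())

sing : V → V
sing c = pairV c c

mark : V → V
mark a = pairV ∅ a

wrap : V → V
wrap c = sing (sing c)

tag : V → V → V
tag a c = pairV (mark a) (wrap c)

∅∈mark : ∀ a → ∅ ∈ mark a
∅∈mark a = true , ≐-refl ∅

∅∉wrap : ∀ c → ¬ (∅ ∈ wrap c)
∅∉wrap c (true , e) = proj₁ (≐-back e true)
∅∉wrap c (false , e) = proj₁ (≐-back e true)

-- "∅ ∈ w" and "∅ ∉ w" as the nonemptiness of a Cond_∈ term, so that they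
-- can serve as conditions of a safe separation.
HasEmpty : V → Set
HasEmpty w = ¬ (condV (sing ∅) ∅ ∅ w ≐ ∅)

LacksEmpty : V → Set
LacksEmpty w = ¬ (condV ∅ (sing ∅) ∅ w ≐ ∅)

HasEmpty-resp : ∀ {u v} → u ≐ v → HasEmpty u → HasEmpty v
HasEmpty-resp e ne e' = ne (≐-trans (condV-congʳ _ _ _ e) e')

mark-HasEmpty : ∀ a → HasEmpty (mark a)
mark-HasEmpty a = condV-inhabitedˡ (∅∈mark a) true

wrap-¬HasEmpty : ∀ c → ¬ HasEmpty (wrap c)
wrap-¬HasEmpty c ne = ne (condV-emptyʳ (∅∉wrap c) λ ())

wrap-LacksEmpty : ∀ c → LacksEmpty (wrap c)
wrap-LacksEmpty c = condV-inhabitedʳ (∅∉wrap c) true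

mark-¬LacksEmpty : ∀ a → ¬ LacksEmpty (mark a)
mark-¬LacksEmpty a ne = ne (condV-emptyˡ (∅∈mark a) λ ())

unionMarked : V → V
unionMarked b = ⋃ (⋃ (sepV HasEmpty (⋃ b)))

unwrap : V → V
unwrap e = ⋃ (⋃ (⋃ (sepV LacksEmpty e)))

unionMarked-cong : ∀ {x y} → x ≐ y → unionMarked x ≐ unionMarked y
unionMarked-cong e = ⋃-cong (⋃-cong (sepV-cong HasEmpty HasEmpty-resp (⋃-cong e)))

unwrap-tag : ∀ a c → unwrap (tag a c) ≐ c
unwrap-tag a (sup C g) =
  (λ { ((((true , le) , _) , _) , _) → ⊥-elim (mark-¬LacksEmpty a le)
     ; ((((false , _) , true) , true) , j) → j , ≐-refl (g j)
     ; ((((false , _) , true) , false) , j) → j , ≐-refl (g j)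
     ; ((((false , _) , false) , true) , j) → j , ≐-refl (g j)
     ; ((((false , _) , false) , false) , j) → j , ≐-refl (g j) }) ,
  (λ j → ((((false , wrap-LacksEmpty (sup C g)) , true) , true) , j) , ≐-refl (g j))

unionMarked-tags : ∀ (a c : V → V) x →
                   unionMarked (image (λ z → tag (a z) (c z)) x) ≐ ⋃ (image a x)
unionMarked-tags a c (sup A g) =
  (λ { ((((i , false) , he) , _) , _) → ⊥-elim (wrap-¬HasEmpty (c (g i)) he)
     ; ((((i , true) , _) , true) , ())
     ; ((((i , true) , _) , false) , j) → (i , j) , ≐-refl (elt (a (g i)) j) }) ,
  (λ { (i , j) → ((((i , true) , mark-HasEmpty (a (g i))) , false) , j) , ≐-refl (elt (a (g i)) j) })

∅ᶜ : ∀ {m} → PCSF⁻ m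
∅ᶜ = comp null (λ ())

_∘ᶜ_ : ∀ {m} → PCSF⁻ 1 → PCSF⁻ m → PCSF⁻ m
g ∘ᶜ t = comp g (λ _ → t)

pairᶜ : ∀ {m} → PCSF⁻ m → PCSF⁻ m → PCSF⁻ m
pairᶜ s t = comp pair λ { zero → s ; (suc zero) → t }

condᶜ : ∀ {m} → PCSF⁻ m → PCSF⁻ m → PCSF⁻ m → PCSF⁻ m → PCSF⁻ m
condᶜ a b c d = comp cond λ
  { zero → a ; (suc zero) → b ; (suc (suc zero)) → c ; (suc (suc (suc zero))) → d }

singᶜ : ∀ {m} → PCSF⁻ m → PCSF⁻ m
singᶜ t = pairᶜ t t

tagᶜ : ∀ {m} → PCSF⁻ m → PCSF⁻ m → PCSF⁻ m
tagᶜ s t = pairᶜ (pairᶜ ∅ᶜ s) (singᶜ (singᶜ t))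

sepHasEmptyᶜ sepLacksEmptyᶜ : PCSF⁻ 1
sepHasEmptyᶜ = sep (condᶜ (singᶜ ∅ᶜ) ∅ᶜ ∅ᶜ (proj zero))
sepLacksEmptyᶜ = sep (condᶜ ∅ᶜ (singᶜ ∅ᶜ) ∅ᶜ (proj zero))

stepᶜ : PCSF⁻ 2
stepᶜ = tagᶜ (proj zero) (union ∘ᶜ (union ∘ᶜ (sepHasEmptyᶜ ∘ᶜ (union ∘ᶜ proj (suc zero)))))

unwrapᶜ : PCSF⁻ 1
unwrapᶜ = union ∘ᶜ (union ∘ᶜ (union ∘ᶜ (sepLacksEmptyᶜ ∘ᶜ proj zero)))

stepᶜ-sem : ∀ a b → ⟦ stepᶜ ⟧⁻ (a ∷ b ∷ []) ≡ tag a (unionMarked b)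
stepᶜ-sem a b = refl

unwrapᶜ-sem : ∀ e → ⟦ unwrapᶜ ⟧⁻ (e ∷ []) ≡ unwrap e
unwrapᶜ-sem e = refl

lookup-∷ʳ-inject₁ : ∀ {a} {A : Set a} {m} (xs : Vec A m) y (j : Fin m) →
                    lookup (xs ∷ʳ y) (inject₁ j) ≡ lookup xs j
lookup-∷ʳ-inject₁ (x ∷ xs) y zero = refl
lookup-∷ʳ-inject₁ (x ∷ xs) y (suc j) = lookup-∷ʳ-inject₁ xs y j

lookup-∷ʳ-last : ∀ {a} {A : Set a} {m} (xs : Vec A m) y → lookup (xs ∷ʳ y) (fromℕ m) ≡ y
lookup-∷ʳ-last [] y = refl
lookup-∷ʳ-last (x ∷ xs) y = lookup-∷ʳ-last xs y

module _ {n m : ℕ} where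

  weakenSafe : PCSF n m → PCSF n (suc m)
  weakenSafe h = scomp h (λ i → proj (i ↑ˡ 0)) (λ j → proj (n ↑ʳ inject₁ j))

  weakenSafe-sem : ∀ h xs as b → ⟦ weakenSafe h ⟧ xs (as ∷ʳ b) ≡ ⟦ h ⟧ xs as
  weakenSafe-sem h xs as b = cong₂ ⟦ h ⟧
    (trans (tabulate-cong (lookup-++ˡ xs [])) (tabulate∘lookup xs))
    (trans (tabulate-cong λ j → trans (lookup-++ʳ xs (as ∷ʳ b) (inject₁ j))
                                      (lookup-∷ʳ-inject₁ as b j))
           (tabulate∘lookup as))

  lastSafe : PCSF n (suc m)
  lastSafe = proj (n ↑ʳ fromℕ m)

  lastSafe-sem : ∀ xs as b → ⟦ lastSafe ⟧ xs (as ∷ʳ b) ≡ b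
  lastSafe-sem xs as b = trans (lookup-++ʳ xs (as ∷ʳ b) (fromℕ m)) (lookup-∷ʳ-last as b)

  step : PCSF n m → PCSF n (suc m)
  step h = scomp (base stepᶜ) (λ ()) λ { zero → weakenSafe h ; (suc zero) → lastSafe }

  step-sem : ∀ h xs as b → ⟦ step h ⟧ xs (as ∷ʳ b) ≡ tag (⟦ h ⟧ xs as) (unionMarked b)
  step-sem h xs as b =
    trans (stepᶜ-sem _ _) (cong₂ (λ u v → tag u (unionMarked v))
                                 (weakenSafe-sem h xs as b) (lastSafe-sem xs as b))

module _ {n m : ℕ} (h : PCSF (suc n) m) where

  tagRec : PCSF (suc n) m
  tagRec = rec (step h)

  tagRec-unfold : ∀ x ys as →
    ⟦ tagRec ⟧ (x ∷ ys) as ≡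
      tag (⟦ h ⟧ (x ∷ ys) as) (unionMarked (image (λ z → ⟦ tagRec ⟧ (z ∷ ys) as) x))
  tagRec-unfold (sup A g) ys as = step-sem h (sup A g ∷ ys) as _

  unionOver : PCSF (suc n) m
  unionOver = scomp (base unwrapᶜ) (λ ()) (λ _ → tagRec)

proposition3p2p8 : ExcludedMiddle → {n m : ℕ} (h : PCSF (suc n) m) →
    Σ (PCSF (suc n) m) λ f →
    (x : V) (ys : Vec V n) (as : Vec V m) →
    ⟦ f ⟧ (x ∷ ys) as ≐ ⋃ (image (λ z → ⟦ h ⟧ (z ∷ ys) as) x)
proposition3p2p8 _ h = unionOver h , correct
  where
  open Setoid ≐-setoid using (reflexive)
  open import Relation.Binary.Reasoning.Setoid ≐-setoid

  correct : ∀ x ys as → ⟦ unionOver h ⟧ (x ∷ ys) as ≐ ⋃ (image (λ z → ⟦ h ⟧ (z ∷ ys) as) x)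
  correct x ys as = begin
    ⟦ unionOver h ⟧ (x ∷ ys) as
      ≡⟨ trans (unwrapᶜ-sem (R x)) (cong unwrap (tagRec-unfold h x ys as)) ⟩
    unwrap (tag (H x) (unionMarked (image R x)))
      ≈⟨ unwrap-tag (H x) _ ⟩
    unionMarked (image R x)
      ≈⟨ unionMarked-cong (image-cong (λ z → reflexive (tagRec-unfold h z ys as)) x) ⟩
    unionMarked (image (λ z → tag (H z) (unionMarked (image R z))) x)
      ≈⟨ unionMarked-tags H (λ z → unionMarked (image R z)) x ⟩
    ⋃ (image H x)
      ∎
    where
    H R : V → V
    H z = ⟦ h ⟧ (z ∷ ys) as
    R z = ⟦ tagRec h ⟧ (z ∷ ys) as
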